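{- For each $k\in\mathbb N$, the ordinal $\omega^{\omega^k}$ (as the structure $(\omega^{\omega^k};\le)$) admits a tree-automatic presentation over an alphabet $\Sigma$ consisting of a single letter.
   Context: Let $\Sigma$ be a finite alphabet. A tree domain is a finite prefix-closed subset $D\subseteq\{0,1\}^\star$; its boundary is $\partial D=\{ud: u\in D, d\in\{0,1\}, ud\notin D\}$ if $D\neq\emptyset$ and $\partial\emptyset=\{\varepsilon\}$. A $\Sigma$-tree is a map $t\colon D\to\Sigma$ with $D=\operatorname{dom}(t)$ a tree domain. A (deterministic bottom-up) tree automaton $\mathcal A=(Q,\iota,\delta,F)$ has finite $Q$, $\iota\in Q$, $\delta\colon\Sigma\times Q\times Q\to Q$, $F\subseteq Q$; $\mathcal A(t,u)=\delta(t(u),\mathcal A(t,u0),\mathcal A(t,u1))$ for $u\in\operatorname{dom}(t)$ and $\mathcal A(t,u)=\iota$ for $u\in\partial\operatorname{dom}(t)$; $L(\mathcal A)=\{t:\mathcal A(t,\varepsilon)\in F\}$. For $\Box\notin\Sigma$, the convolution $\otimes(t_1,\dots,t_n)$ is the $(\Sigma\cup\{\Box\})^n$-tree with domain $\bigcup_i\operatorname{dom}(t_i)$ and label at $u$ the tuple of $t_i(u)$, with $\Box$ where $u\notin\operatorname{dom}(t_i)$. A tree-automatic presentation over $\Sigma$ of a structure $\mathfrak A$ with finitely many relations is a tuple $(\mathcal A;(\mathcal A_R)_R)$ of tree automata, with $L(\mathcal A)$ a set of $\Sigma$-trees, together with a bijection $\mu\colon A\to L(\mathcal A)$ such that each $\mathcal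 A_R$ recognises $\{\otimes\bar t:\bar t\in\mu(R^{\mathfrak A})\}$. -}

module Defs where

open import Data.Nat using (ℕ; _<_)
open import Data.Fin using (Fin)
open import Data.Bool using (Bool; true)
open import Data.Maybe using (Maybe; just; nothing)
open import Data.Product using (Σ; ∃; _×_; _,_; proj₁; proj₂)
open import Data.Sum using (_⊎_)
open import Data.List using (List; []; _∷_)
open import Data.Vec using (Vec; []; _∷_)
open import Relation.Binary.PropositionalEquality using (_≡_)
open import Function.Bundles using (_⇔_)

-- A Σ-tree t : D → Σ with D a finite prefix-closed subset of
-- {0,1}* is represented as a finite binary tree: 'leaf' stands for a
-- position of the boundary ∂D (or for the empty tree when at the root),
-- 'node a l r' for a position u ∈ D with label a, left child u0, right u1.

data Tree (Γ : Set) : Set where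
  leaf : Tree Γ
  node : Γ → Tree Γ → Tree Γ → Tree Γ

record TreeAutomaton (Γ : Set) : Set where
  field
    nQ : ℕ
    ι  : Fin nQ
    δ  : Γ → Fin nQ → Fin nQ → Fin nQ
    F  : Fin nQ → Bool

run : ∀ {Γ} (𝒜 : TreeAutomaton Γ) → Tree Γ → Fin (TreeAutomaton.nQ 𝒜)
run 𝒜 leaf = TreeAutomaton.ι 𝒜
run 𝒜 (node a l r) = TreeAutomaton.δ 𝒜 a (run 𝒜 l) (run 𝒜 r)

Accepts : ∀ {Γ} → TreeAutomaton Γ → Tree Γ → Set
Accepts 𝒜 t = TreeAutomaton.F 𝒜 (run 𝒜 t) ≡ true

-- Convolution of two Γ-trees; Γ ∪ {□} is 'Maybe Γ' with □ = nothing.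

conv : ∀ {Γ} → Tree Γ → Tree Γ → Tree (Maybe Γ × Maybe Γ)
conv leaf leaf = leaf
conv leaf (node b l' r') = node (nothing , just b) (conv leaf l') (conv leaf r')
conv (node a l r) leaf = node (just a , nothing) (conv l leaf) (conv r leaf)
conv (node a l r) (node b l' r') = node (just a , just b) (conv l l') (conv r r')

-- Tree-automatic presentation over Γ of a structure (A ; R) with a single
-- binary relation R.  Elements of A are compared with the equivalence _≈_
-- (the carrier's notion of equality).

record TreeAutomaticPresentation (Γ : Set) (A : Set) (_≈_ : A → A → Set)
                                 (R : A → A → Set) : Set₁ where
  field
    𝒜  : TreeAutomaton Γ
    𝒜R : TreeAutomaton (Maybe Γ × Maybe Γ)
    μ  : A → Tree Γ
    μ-injective  : ∀ x y → μ x ≡ μ y → x ≈ y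
    μ-into       : ∀ x → Accepts 𝒜 (μ x)
    μ-onto       : ∀ t → Accepts 𝒜 t → ∃ λ x → μ x ≡ t
    𝒜R-correct   : ∀ s → Accepts 𝒜R s ⇔ (∃ λ x → ∃ λ y → R x y × conv (μ x) (μ y) ≡ s)

-- The ordinal ω^(ω^k), via Cantor normal forms.
-- ω^k is represented by Vec ℕ k with the lexicographic order (most
-- significant coordinate first).

data _<ₗ_ : ∀ {k} → Vec ℕ k → Vec ℕ k → Set where
  here  : ∀ {k a b} {xs ys : Vec ℕ k} → a < b → (a ∷ xs) <ₗ (b ∷ ys)
  there : ∀ {k a} {xs ys : Vec ℕ k} → xs <ₗ ys → (a ∷ xs) <ₗ (a ∷ ys)

-- A term (e , c) stands for ω^e · (1 + c)  (positive coefficient).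
Term : ℕ → Set
Term k = Vec ℕ k × ℕ

data Decreasing {k : ℕ} : List (Term k) → Set where
  []  : Decreasing []
  [_] : ∀ t → Decreasing (t ∷ [])
  _∷_ : ∀ {t u ts} → proj₁ u <ₗ proj₁ t → Decreasing (u ∷ ts) → Decreasing (t ∷ u ∷ ts)

Ord : ℕ → Set
Ord k = Σ (List (Term k)) Decreasing

_≈ₒ_ : ∀ {k} → Ord k → Ord k → Set
x ≈ₒ y = proj₁ x ≡ proj₁ y

_<ₜ_ : ∀ {k} → Term k → Term k → Set
(e , c) <ₜ (e' , c') = (e <ₗ e') ⊎ ((e ≡ e') × (c < c'))

data _<ᶜ_ {k : ℕ} : List (Term k) → List (Term k) → Set where
  nil  : ∀ {t ts} → [] <ᶜ (t ∷ ts)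
  head : ∀ {t t' ts ts'} → t <ₜ t' → (t ∷ ts) <ᶜ (t' ∷ ts')
  tail : ∀ {t ts ts'} → ts <ᶜ ts' → (t ∷ ts) <ᶜ (t ∷ ts')

_≤ₒ_ : ∀ {k} → Ord k → Ord k → Set
x ≤ₒ y = (proj₁ x <ᶜ proj₁ y) ⊎ (proj₁ x ≡ proj₁ y)

-- Over a one-letter alphabet a tree is just a finite binary tree shape.
-- A Cantor normal form of an ordinal below ω^(ω^k) is coded by a shape by
-- recursion on k: for k = 0 the ordinal c + 1 < ω becomes a root with an
-- empty left subtree and a right spine of length c; for k + 1 the terms
-- are grouped by the leading coordinate of their exponent, and the group
-- with leading coordinate n is coded (at level k) as the left subtree
-- hanging at depth (max − n) of a right spine.
--
-- Structure: (1) a tree function with finitely many values that is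
-- computed bottom-up is computed by a tree automaton; (2) one comparison
-- 'cmp' of shapes, independent of k (longer right spine is larger, ties
-- broken lexicographically), into which the coding is an order embedding;
-- (3) the image of the coding is the set of shapes 'valid k', again
-- computed bottom-up.  The domain automaton tests validity, the order
-- automaton tests that its input is a convolution of valid shapes s ≤ s'.

module Submission where

open import Defs
open import Data.Nat using (ℕ; zero; suc; _*_; _<_; _≤_; s≤s; _≟_)
open import Data.Nat.Properties
  using (≤-refl; ≤-reflexive; ≤-trans; <⇒≤; <⇒≢; <⇒≱; ≤∧≢⇒<; <-cmp; suc-injective; n≤1+n; m≤n⇒m<n∨m≡n; m<1+n⇒m≤n)
open import Data.Fin using (Fin; zero; suc; combine; remQuot)
open import Data.Fin.Properties using (remQuot-combine; 2↔Bool)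
open import Data.Bool using (Bool; true; false; _∧_; not)
open import Data.Unit using (⊤; tt)
open import Data.Empty using (⊥-elim)
open import Data.Product using (Σ; ∃; _×_; _,_; proj₁; uncurry)
open import Data.Product.Function.NonDependent.Propositional using (_×-⇔_)
open import Data.Sum using (_⊎_; inj₁; inj₂)
open import Data.List using (List; []; _∷_; _++_; map)
open import Data.Vec using (Vec; []; _∷_; zipWith) renaming (head to headᵛ)
open import Data.Vec.Properties using (∷-injectiveʳ)
open import Data.Maybe using (Maybe; just; nothing)
open import Relation.Nullary using (yes; no; ¬_)
open import Relation.Binary using (tri<; tri≈; tri>)
open import Relation.Binary.PropositionalEquality
open import Function using (_∘_; id)
open import Function.Bundles using (_⇔_; mk⇔; Equivalence; Inverse)
open import Function.Construct.Identity using (⇔-id)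
open import Function.Construct.Composition using (_⇔-∘_)

-- Finite types and automata computing tree functions

-- A type is finite when it is a retract of some Fin n; automaton states
-- have to live in Fin n, so every state space used below is shown finite.
record Finite (S : Set) : Set where
  field
    size          : ℕ
    encode        : S → Fin size
    decode        : Fin size → S
    decode-encode : ∀ s → decode (encode s) ≡ s
open Finite

finite-Fin : ∀ n → Finite (Fin n)
finite-Fin n = record { size = n ; encode = id ; decode = id ; decode-encode = λ _ → refl }

retract : ∀ {A B : Set} → Finite A → (f : A → B) (g : B → A) → (∀ b → f (g b) ≡ b) → Finite B
retract FA f g fg = record
  { size = size FA ; encode = encode FA ∘ g ; decode = f ∘ decode FA
  ; decode-encode = λ b → trans (cong f (decode-encode FA (g b))) (fg b) }

finite-Bool : Finite Bool
finite-Bool = retract (finite-Fin 2) (Inverse.to 2↔Bool) (Inverse.from 2↔Bool) (Inverse.strictlyInverseˡ 2↔Bool)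

-- Pairs are encoded by 'combine'/'remQuot'.  The encoding is opaque: only
-- 'decode-encode' is needed, and keeping the arithmetic folded keeps type
-- checking of the automata below cheap.
opaque
  finite-× : ∀ {A B : Set} → Finite A → Finite B → Finite (A × B)
  finite-× FA FB = retract (finite-Fin (size FA * size FB))
    (λ i → let (a , b) = remQuot (size FB) i in decode FA a , decode FB b)
    (λ (a , b) → combine (encode FA a) (encode FB b))
    (λ (a , b) → trans
       (cong (λ (i , j) → decode FA i , decode FB j) (remQuot-combine (encode FA a) (encode FB b)))
       (cong₂ _,_ (decode-encode FA a) (decode-encode FB b)))

finite-Vec : ∀ {A : Set} → Finite A → ∀ n → Finite (Vec A n)
finite-Vec FA zero = retract (finite-Fin 1) (λ _ → []) (λ _ → zero) (λ { [] → refl })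
finite-Vec FA (suc n) = retract (finite-× FA (finite-Vec FA n))
  (uncurry _∷_) (λ { (x ∷ xs) → x , xs }) (λ { (x ∷ xs) → refl })

module Computing {Γ S : Set} (finite : Finite S) (σ : Tree Γ → S) (step : Γ → S → S → S)
                 (σ-node : ∀ a l r → σ (node a l r) ≡ step a (σ l) (σ r)) (final : S → Bool) where

  automaton : TreeAutomaton Γ
  automaton = record
    { nQ = size finite
    ; ι  = encode finite (σ leaf)
    ; δ  = λ a p q → encode finite (step a (decode finite p) (decode finite q))
    ; F  = final ∘ decode finite }

  run-automaton : ∀ t → run automaton t ≡ encode finite (σ t)
  run-automaton leaf = refl
  run-automaton (node a l r) = begin
    encode finite (step a (decode finite (run automaton l)) (decode finite (run automaton r)))
      ≡⟨ cong₂ (λ p q → encode finite (step a (decode finite p) (decode finite q)))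
               (run-automaton l) (run-automaton r) ⟩
    encode finite (step a (decode finite (encode finite (σ l))) (decode finite (encode finite (σ r))))
      ≡⟨ cong₂ (λ p q → encode finite (step a p q)) (decode-encode finite (σ l)) (decode-encode finite (σ r)) ⟩
    encode finite (step a (σ l) (σ r))
      ≡⟨ cong (encode finite) (sym (σ-node a l r)) ⟩
    encode finite (σ (node a l r)) ∎
    where open ≡-Reasoning

  accepts : ∀ t → Accepts automaton t ⇔ final (σ t) ≡ true
  accepts t = mk⇔ (trans (sym final-run)) (trans final-run)
    where
    final-run : final (decode finite (run automaton t)) ≡ final (σ t)
    final-run = trans (cong (final ∘ decode finite) (run-automaton t)) (cong final (decode-encode finite (σ t)))

∧-true : ∀ {a b} → a ∧ b ≡ true ⇔ (a ≡ true × b ≡ true)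
∧-true {true} {true} = mk⇔ (λ _ → refl , refl) (λ _ → refl)
∧-true {true} {false} = mk⇔ (λ ()) (λ ())
∧-true {false} = mk⇔ (λ ()) (λ ())

∧₄-true : ∀ {a b c d} → a ∧ (b ∧ (c ∧ d)) ≡ true ⇔ (a ≡ true × b ≡ true × c ≡ true × d ≡ true)
∧₄-true = (⇔-id _ ×-⇔ (⇔-id _ ×-⇔ ∧-true)) ⇔-∘ ((⇔-id _ ×-⇔ ∧-true) ⇔-∘ ∧-true)

-- A total order on binary tree shapes

data Cmp : Set where
  lt eq gt : Cmp

finite-Cmp : Finite Cmp
finite-Cmp = retract (finite-Fin 3) fromFin toFin (λ { lt → refl ; eq → refl ; gt → refl })
  where
  fromFin : Fin 3 → Cmp
  fromFin zero = lt
  fromFin (suc zero) = eq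
  fromFin (suc (suc _)) = gt
  toFin : Cmp → Fin 3
  toFin lt = zero
  toFin eq = suc zero
  toFin gt = suc (suc zero)

opposite : Cmp → Cmp
opposite lt = gt
opposite eq = eq
opposite gt = lt

infixr 5 _⊙_
_⊙_ : Cmp → Cmp → Cmp
lt ⊙ _ = lt
eq ⊙ o = o
gt ⊙ _ = gt

⊙-opposite : ∀ o o' → opposite o ⊙ opposite o' ≡ opposite (o ⊙ o')
⊙-opposite lt o' = refl
⊙-opposite eq o' = refl
⊙-opposite gt o' = refl

leq : Cmp → Bool
leq lt = true
leq eq = true
leq gt = false

Shape : Set
Shape = Tree ⊤

spineLength : Shape → ℕ
spineLength leaf = zero
spineLength (node _ _ r) = suc (spineLength r)

spineCmp : Shape → Shape → Cmp
spineCmp leaf leaf = eq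
spineCmp leaf (node _ _ _) = lt
spineCmp (node _ _ _) leaf = gt
spineCmp (node _ _ r) (node _ _ r') = spineCmp r r'

-- Shapes are compared first by the spine lengths of their right subtrees,
-- then lexicographically by left and right subtrees.  The coding of every
-- ω^(ω^k) embeds into this single order.
cmp : Shape → Shape → Cmp
cmp leaf leaf = eq
cmp leaf (node _ _ _) = lt
cmp (node _ _ _) leaf = gt
cmp (node _ l r) (node _ l' r') = spineCmp r r' ⊙ cmp l l' ⊙ cmp r r'

spineCmp-< : ∀ t u → spineLength t < spineLength u → spineCmp t u ≡ lt
spineCmp-< leaf (node _ _ _) _ = refl
spineCmp-< (node _ _ r) (node _ _ r') (s≤s p) = spineCmp-< r r' p

spineCmp-≡ : ∀ t u → spineLength t ≡ spineLength u → spineCmp t u ≡ eq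
spineCmp-≡ leaf leaf _ = refl
spineCmp-≡ (node _ _ r) (node _ _ r') p = spineCmp-≡ r r' (suc-injective p)

spineCmp-opposite : ∀ t u → spineCmp u t ≡ opposite (spineCmp t u)
spineCmp-opposite leaf leaf = refl
spineCmp-opposite leaf (node _ _ _) = refl
spineCmp-opposite (node _ _ _) leaf = refl
spineCmp-opposite (node _ _ r) (node _ _ r') = spineCmp-opposite r r'

cmp-refl : ∀ t → cmp t t ≡ eq
cmp-refl leaf = refl
cmp-refl (node _ l r) rewrite spineCmp-≡ r r refl | cmp-refl l | cmp-refl r = refl

cmp-opposite : ∀ t u → cmp u t ≡ opposite (cmp t u)
cmp-opposite leaf leaf = refl
cmp-opposite leaf (node _ _ _) = refl
cmp-opposite (node _ _ _) leaf = refl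
cmp-opposite (node _ l r) (node _ l' r')
  rewrite spineCmp-opposite r r' | cmp-opposite l l' | cmp-opposite r r'
        | ⊙-opposite (cmp l l') (cmp r r') = ⊙-opposite (spineCmp r r') (cmp l l' ⊙ cmp r r')

lex-trichotomy : ∀ {k} (e e' : Vec ℕ k) → e <ₗ e' ⊎ e ≡ e' ⊎ e' <ₗ e
lex-trichotomy [] [] = inj₂ (inj₁ refl)
lex-trichotomy (a ∷ e) (b ∷ e') with <-cmp a b
... | tri< a<b _ _ = inj₁ (here a<b)
... | tri> _ _ b<a = inj₂ (inj₂ (here b<a))
... | tri≈ _ refl _ with lex-trichotomy e e'
...   | inj₁ e<e' = inj₁ (there e<e')
...   | inj₂ (inj₁ refl) = inj₂ (inj₁ refl)
...   | inj₂ (inj₂ e'<e) = inj₂ (inj₂ (there e'<e))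

term-trichotomy : ∀ {k} (t u : Term k) → t <ₜ u ⊎ t ≡ u ⊎ u <ₜ t
term-trichotomy (e , c) (e' , c') with lex-trichotomy e e'
... | inj₁ e<e' = inj₁ (inj₁ e<e')
... | inj₂ (inj₂ e'<e) = inj₂ (inj₂ (inj₁ e'<e))
... | inj₂ (inj₁ refl) with <-cmp c c'
...   | tri< c<c' _ _ = inj₁ (inj₂ (refl , c<c'))
...   | tri≈ _ refl _ = inj₂ (inj₁ refl)
...   | tri> _ _ c'<c = inj₂ (inj₂ (inj₂ (refl , c'<c)))

trichotomy : ∀ {k} (xs ys : List (Term k)) → xs <ᶜ ys ⊎ xs ≡ ys ⊎ ys <ᶜ xs
trichotomy [] [] = inj₂ (inj₁ refl)
trichotomy [] (_ ∷ _) = inj₁ nil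
trichotomy (_ ∷ _) [] = inj₂ (inj₂ nil)
trichotomy (t ∷ xs) (u ∷ ys) with term-trichotomy t u
... | inj₁ t<u = inj₁ (head t<u)
... | inj₂ (inj₂ u<t) = inj₂ (inj₂ (head u<t))
... | inj₂ (inj₁ refl) with trichotomy xs ys
...   | inj₁ xs<ys = inj₁ (tail xs<ys)
...   | inj₂ (inj₁ refl) = inj₂ (inj₁ refl)
...   | inj₂ (inj₂ ys<xs) = inj₂ (inj₂ (tail ys<xs))

-- Coding normal forms by shapes

lead : ∀ {k} → Term (suc k) → ℕ
lead (m ∷ _ , _) = m

-- Bounded n ts: the first term of ts, hence every term of a normal form,
-- has leading exponent coordinate below n.
Bounded : ∀ {k} → ℕ → List (Term (suc k)) → Set
Bounded n [] = ⊤
Bounded n (t ∷ _) = lead t < n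

group : ∀ {k} → ℕ → List (Term (suc k)) → List (Term k)
group n [] = []
group n ((m ∷ e , c) ∷ ts) with m ≟ n
... | yes _ = (e , c) ∷ group n ts
... | no _ = []

rest : ∀ {k} → ℕ → List (Term (suc k)) → List (Term (suc k))
rest n [] = []
rest n ((m ∷ e , c) ∷ ts) with m ≟ n
... | yes _ = rest n ts
... | no _ = (m ∷ e , c) ∷ ts

spine : ℕ → Shape
spine zero = leaf
spine (suc c) = node tt leaf (spine c)

mutual
  code : ∀ k → List (Term k) → Shape
  code zero [] = leaf
  code zero ((_ , c) ∷ _) = node tt leaf (spine c)
  code (suc k) [] = leaf
  code (suc k) (t ∷ ts) = codeBelow k (suc (lead t)) (t ∷ ts)

  -- for ts bounded by n: a right spine of n nodes, whose left subtree at
  -- depth i is the code of the group with leading coordinate n − 1 − i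
  codeBelow : ∀ k → ℕ → List (Term (suc k)) → Shape
  codeBelow k zero ts = leaf
  codeBelow k (suc n) ts = node tt (code k (group n ts)) (codeBelow k n (rest n ts))

group-here : ∀ {k} n {e : Vec ℕ k} {c ts} → group n ((n ∷ e , c) ∷ ts) ≡ (e , c) ∷ group n ts
group-here n with n ≟ n
... | yes _ = refl
... | no n≢n = ⊥-elim (n≢n refl)

rest-here : ∀ {k} n {e : Vec ℕ k} {c ts} → rest n ((n ∷ e , c) ∷ ts) ≡ rest n ts
rest-here n with n ≟ n
... | yes _ = refl
... | no n≢n = ⊥-elim (n≢n refl)

group-other : ∀ {k n m} {e : Vec ℕ k} {c ts} → ¬ m ≡ n → group n ((m ∷ e , c) ∷ ts) ≡ []
group-other {n = n} {m} m≢n with m ≟ n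
... | yes m≡n = ⊥-elim (m≢n m≡n)
... | no _ = refl

rest-other : ∀ {k n m} {e : Vec ℕ k} {c ts} → ¬ m ≡ n → rest n ((m ∷ e , c) ∷ ts) ≡ (m ∷ e , c) ∷ ts
rest-other {n = n} {m} m≢n with m ≟ n
... | yes m≡n = ⊥-elim (m≢n m≡n)
... | no _ = refl

code-[] : ∀ k → code k [] ≡ leaf
code-[] zero = refl
code-[] (suc k) = refl

spineLength-spine : ∀ c → spineLength (spine c) ≡ c
spineLength-spine zero = refl
spineLength-spine (suc c) = cong suc (spineLength-spine c)

spineLength-codeBelow : ∀ k n ts → spineLength (codeBelow k n ts) ≡ n
spineLength-codeBelow k zero ts = refl
spineLength-codeBelow k (suc n) ts = cong suc (spineLength-codeBelow k n (rest n ts))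

decreasing-tail : ∀ {k} {t : Term k} {ts} → Decreasing (t ∷ ts) → Decreasing ts
decreasing-tail [ _ ] = []
decreasing-tail (_ ∷ d) = d

lead-≤ₗ : ∀ {k} {t u : Term (suc k)} → proj₁ t <ₗ proj₁ u → lead t ≤ lead u
lead-≤ₗ {t = _ ∷ _ , _} {_ ∷ _ , _} (here p) = <⇒≤ p
lead-≤ₗ {t = _ ∷ _ , _} {_ ∷ _ , _} (there _) = ≤-refl

lead-≤ₜ : ∀ {k} {t u : Term (suc k)} → t <ₜ u → lead t ≤ lead u
lead-≤ₜ (inj₁ p) = lead-≤ₗ p
lead-≤ₜ {t = _ ∷ _ , _} (inj₂ (refl , _)) = ≤-refl

lead-≤ᶜ : ∀ {k} {t u : Term (suc k)} {ts us} → (t ∷ ts) <ᶜ (u ∷ us) → lead t ≤ lead u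
lead-≤ᶜ (head p) = lead-≤ₜ p
lead-≤ᶜ (tail _) = ≤-refl

bounded-tail : ∀ {k} {t : Term (suc k)} {ts} → Decreasing (t ∷ ts) → Bounded (suc (lead t)) ts
bounded-tail {ts = []} _ = tt
bounded-tail {ts = _ ∷ _} (p ∷ _) = s≤s (lead-≤ₗ p)

drop-lead : ∀ {k n} {e e' : Vec ℕ k} {c c'} → (n ∷ e , c) <ₜ (n ∷ e' , c') → (e , c) <ₜ (e' , c')
drop-lead (inj₁ (here n<n)) = ⊥-elim (<⇒≢ n<n refl)
drop-lead (inj₁ (there e<e')) = inj₁ e<e'
drop-lead (inj₂ (e≡e' , c<c')) = inj₂ (∷-injectiveʳ e≡e' , c<c')

rest-decreasing : ∀ {k} n {ts : List (Term (suc k))} → Decreasing ts → Decreasing (rest n ts)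
rest-decreasing n {[]} d = d
rest-decreasing n {(m ∷ e , c) ∷ ts} d with m ≟ n
... | yes _ = rest-decreasing n (decreasing-tail d)
... | no _ = d

rest-bounded : ∀ {k} n {ts : List (Term (suc k))} → Decreasing ts → Bounded (suc n) ts → Bounded n (rest n ts)
rest-bounded n {[]} _ _ = tt
rest-bounded n {(m ∷ e , c) ∷ ts} d b with m ≟ n
... | yes refl = rest-bounded n (decreasing-tail d) (bounded-tail d)
... | no m≢n = ≤∧≢⇒< (m<1+n⇒m≤n b) m≢n

group-decreasing-here : ∀ {k} n {e : Vec ℕ k} {c} ts → Decreasing ((n ∷ e , c) ∷ ts) → Decreasing ((e , c) ∷ group n ts)
group-decreasing-here n [] _ = [ _ ]
group-decreasing-here n ((m ∷ e' , c') ∷ ts) (here m<n ∷ _)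
  rewrite group-other {n = n} {m} {e'} {c'} {ts} (<⇒≢ m<n) = [ _ ]
group-decreasing-here n ((_ ∷ e' , c') ∷ ts) (there e'<e ∷ d)
  rewrite group-here n {e'} {c'} {ts} = e'<e ∷ group-decreasing-here n ts d

group-decreasing : ∀ {k} n {ts : List (Term (suc k))} → Decreasing ts → Decreasing (group n ts)
group-decreasing n {[]} d = []
group-decreasing n {(m ∷ e , c) ∷ ts} d with m ≟ n
... | no _ = []
... | yes refl = group-decreasing-here m ts d

split : ∀ {k} n {ts us : List (Term (suc k))} → Decreasing ts → Decreasing us
      → Bounded (suc n) ts → Bounded (suc n) us → ts <ᶜ us
      → group n ts <ᶜ group n us ⊎ (group n ts ≡ group n us × rest n ts <ᶜ rest n us)
split n {[]} {(m ∷ e , c) ∷ us} _ _ _ _ nil with m ≟ n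
... | yes _ = inj₁ nil
... | no _ = inj₂ (refl , nil)
split n {(a ∷ e , c) ∷ ts} {(b ∷ e' , c') ∷ us} _ _ _ bu (head p) with a ≟ n | b ≟ n
... | yes refl | yes refl = inj₁ (head (drop-lead p))
... | yes refl | no b≢n = ⊥-elim (<⇒≱ (≤∧≢⇒< (m<1+n⇒m≤n bu) b≢n) (lead-≤ₜ p))
... | no _ | yes _ = inj₁ nil
... | no _ | no _ = inj₂ (refl , head p)
split n {(a ∷ e , c) ∷ ts} {_ ∷ us} dt du _ _ (tail q) with a ≟ n
... | no _ = inj₂ (refl , tail q)
... | yes refl with split a (decreasing-tail dt) (decreasing-tail du) (bounded-tail dt) (bounded-tail du) q
...   | inj₁ g< = inj₁ (tail g<)
...   | inj₂ (g≡ , r<) = inj₂ (cong ((e , c) ∷_) g≡ , r<)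

codeBelow-spineCmp-< : ∀ k {m n} ts us → m < n → spineCmp (codeBelow k m ts) (codeBelow k n us) ≡ lt
codeBelow-spineCmp-< k {m} {n} ts us m<n = spineCmp-< _ _
  (subst₂ _<_ (sym (spineLength-codeBelow k m ts)) (sym (spineLength-codeBelow k n us)) m<n)

codeBelow-spineCmp-≡ : ∀ k n ts us → spineCmp (codeBelow k n ts) (codeBelow k n us) ≡ eq
codeBelow-spineCmp-≡ k n ts us =
  spineCmp-≡ _ _ (trans (spineLength-codeBelow k n ts) (sym (spineLength-codeBelow k n us)))

-- A strictly smaller leading
-- coordinate gives a shorter spine; equal ones are compared group by group.
mutual
  code-mono : ∀ k {xs ys} → Decreasing xs → Decreasing ys → xs <ᶜ ys → cmp (code k xs) (code k ys) ≡ lt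
  code-mono zero _ _ nil = refl
  code-mono zero _ _ (head (inj₁ ()))
  code-mono zero {(_ , c) ∷ _} {(_ , c') ∷ _} _ _ (head (inj₂ (_ , c<c')))
    rewrite spineCmp-< (spine c) (spine c')
              (subst₂ _<_ (sym (spineLength-spine c)) (sym (spineLength-spine c')) c<c') = refl
  code-mono zero _ [ _ ] (tail ())
  code-mono zero (() ∷ _) _ (tail _)
  code-mono zero _ (() ∷ _) (tail _)
  code-mono (suc k) _ _ nil = refl
  code-mono (suc k) {t ∷ ts} {u ∷ us} dt du t∷ts<u∷us with m≤n⇒m<n∨m≡n (lead-≤ᶜ t∷ts<u∷us)
  ... | inj₁ t<u rewrite codeBelow-spineCmp-< k (rest (lead t) (t ∷ ts)) (rest (lead u) (u ∷ us)) t<u = refl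
  ... | inj₂ t≡u =
    subst (λ n → cmp (codeBelow k (suc (lead t)) (t ∷ ts)) (codeBelow k (suc n) (u ∷ us)) ≡ lt) t≡u
      (codeBelow-mono k (suc (lead t)) dt du ≤-refl (s≤s (≤-reflexive (sym t≡u))) t∷ts<u∷us)

  codeBelow-mono : ∀ k n {ts us} → Decreasing ts → Decreasing us → Bounded n ts → Bounded n us → ts <ᶜ us
                 → cmp (codeBelow k n ts) (codeBelow k n us) ≡ lt
  codeBelow-mono k zero {[]} {_ ∷ _} _ _ _ () _
  codeBelow-mono k zero {_ ∷ _} _ _ () _ _
  codeBelow-mono k (suc n) {ts} {us} dt du bt bu ts<us
    rewrite codeBelow-spineCmp-≡ k n (rest n ts) (rest n us)
    with split n dt du bt bu ts<us
  ... | inj₁ g< rewrite code-mono k (group-decreasing n dt) (group-decreasing n du) g< = refl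
  ... | inj₂ (g≡ , r<) rewrite g≡ | cmp-refl (code k (group n us)) =
    codeBelow-mono k n (rest-decreasing n dt) (rest-decreasing n du) (rest-bounded n dt bt) (rest-bounded n du bu) r<

Reflects : ∀ {k} → Cmp → List (Term k) → List (Term k) → Set
Reflects lt xs ys = xs <ᶜ ys
Reflects eq xs ys = xs ≡ ys
Reflects gt xs ys = ys <ᶜ xs

code-reflects : ∀ k {xs ys} → Decreasing xs → Decreasing ys → Reflects (cmp (code k xs) (code k ys)) xs ys
code-reflects k {xs} {ys} dx dy with trichotomy xs ys
... | inj₁ xs<ys rewrite code-mono k dx dy xs<ys = xs<ys
... | inj₂ (inj₁ refl) rewrite cmp-refl (code k xs) = refl
... | inj₂ (inj₂ ys<xs) rewrite cmp-opposite (code k ys) (code k xs) | code-mono k dy dx ys<xs = ys<xs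

-- injectivity: equal codes compare as 'eq'
code-injective : ∀ k {xs ys} → Decreasing xs → Decreasing ys → code k xs ≡ code k ys → xs ≡ ys
code-injective k {xs} {ys} dx dy same = subst (λ o → Reflects o xs ys) cmp≡eq (code-reflects k dx dy)
  where
  cmp≡eq : cmp (code k xs) (code k ys) ≡ eq
  cmp≡eq = trans (cong (cmp (code k xs)) (sym same)) (cmp-refl (code k xs))

code-leq : ∀ k {xs ys} → Decreasing xs → Decreasing ys
         → (xs <ᶜ ys ⊎ xs ≡ ys) ⇔ leq (cmp (code k xs) (code k ys)) ≡ true
code-leq k {xs} {ys} dx dy = mk⇔ to (from (cmp (code k xs) (code k ys)) (code-reflects k dx dy))
  where
  to : xs <ᶜ ys ⊎ xs ≡ ys → leq (cmp (code k xs) (code k ys)) ≡ true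
  to (inj₁ xs<ys) = cong leq (code-mono k dx dy xs<ys)
  to (inj₂ refl) = cong leq (cmp-refl (code k xs))
  from : ∀ o → Reflects o xs ys → leq o ≡ true → xs <ᶜ ys ⊎ xs ≡ ys
  from lt xs<ys _ = inj₁ xs<ys
  from eq xs≡ys _ = inj₂ xs≡ys

-- The image of the coding: valid shapes

nonEmpty : Shape → Bool
nonEmpty leaf = false
nonEmpty (node _ _ _) = true

isSpine : Shape → Bool
isSpine leaf = true
isSpine (node _ l r) = not (nonEmpty l) ∧ isSpine r

mutual
  valid : ℕ → Shape → Bool
  valid zero t = isSpine t
  valid (suc j) leaf = true
  valid (suc j) (node _ l r) = nonEmpty l ∧ (valid j l ∧ validBelow j r)

  validBelow : ℕ → Shape → Bool
  validBelow j leaf = true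
  validBelow j (node _ l r) = valid j l ∧ validBelow j r

spine-isSpine : ∀ c → isSpine (spine c) ≡ true
spine-isSpine zero = refl
spine-isSpine (suc c) = spine-isSpine c

code-nonEmpty : ∀ k t ts → nonEmpty (code k (t ∷ ts)) ≡ true
code-nonEmpty zero _ _ = refl
code-nonEmpty (suc k) _ _ = refl

mutual
  code-valid : ∀ k {xs} → Decreasing xs → valid k (code k xs) ≡ true
  code-valid zero {[]} _ = refl
  code-valid zero {(_ , c) ∷ _} _ = spine-isSpine c
  code-valid (suc k) {[]} _ = refl
  code-valid (suc k) {(a ∷ e , c) ∷ ts} d = Equivalence.from ∧-true
    ( subst (λ g → nonEmpty (code k g) ≡ true) (sym (group-here a)) (code-nonEmpty k _ _)
    , Equivalence.from ∧-true (code-valid k (group-decreasing a d) , codeBelow-valid k a (rest-decreasing a d)))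

  codeBelow-valid : ∀ k n {ts} → Decreasing ts → validBelow k (codeBelow k n ts) ≡ true
  codeBelow-valid k zero _ = refl
  codeBelow-valid k (suc n) d =
    Equivalence.from ∧-true (code-valid k (group-decreasing n d) , codeBelow-valid k n (rest-decreasing n d))

extend : ∀ {k} → ℕ → Term k → Term (suc k)
extend m (e , c) = m ∷ e , c

group-extend : ∀ {k} m (xs : List (Term k)) ts → Bounded m ts → group m (map (extend m) xs ++ ts) ≡ xs
group-extend m [] [] _ = refl
group-extend m [] ((_ ∷ _ , _) ∷ _) b = group-other (<⇒≢ b)
group-extend m ((e , c) ∷ xs) ts b = trans (group-here m) (cong ((e , c) ∷_) (group-extend m xs ts b))

rest-extend : ∀ {k} m (xs : List (Term k)) ts → Bounded m ts → rest m (map (extend m) xs ++ ts) ≡ ts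
rest-extend m [] [] _ = refl
rest-extend m [] ((_ ∷ _ , _) ∷ _) b = rest-other (<⇒≢ b)
rest-extend m ((e , c) ∷ xs) ts b = trans (rest-here m) (rest-extend m xs ts b)

extend-decreasing : ∀ {k} m {xs : List (Term k)} {ts} → Decreasing xs → Decreasing ts → Bounded m ts
                  → Decreasing (map (extend m) xs ++ ts)
extend-decreasing m [] dts _ = dts
extend-decreasing m {ts = []} [ _ ] _ _ = [ _ ]
extend-decreasing m {ts = (_ ∷ _ , _) ∷ _} [ _ , _ ] dts b = here b ∷ dts
extend-decreasing m {xs = (_ , _) ∷ (_ , _) ∷ _} (p ∷ dxs) dts b = there p ∷ extend-decreasing m dxs dts b

extend-bounded : ∀ {k} m (xs : List (Term k)) {ts} → Bounded m ts → Bounded (suc m) (map (extend m) xs ++ ts)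
extend-bounded m [] {[]} _ = tt
extend-bounded m [] {_ ∷ _} b = ≤-trans b (n≤1+n _)
extend-bounded m (_ ∷ _) _ = ≤-refl

codeBelow-extend : ∀ k n xs {ts} → Bounded n ts
                 → codeBelow k (suc n) (map (extend n) xs ++ ts) ≡ node tt (code k xs) (codeBelow k n ts)
codeBelow-extend k n xs {ts} b =
  cong₂ (λ g r → node tt (code k g) (codeBelow k n r)) (group-extend n xs ts b) (rest-extend n xs ts b)

isSpine-spine : ∀ t → isSpine t ≡ true → t ≡ spine (spineLength t)
isSpine-spine leaf _ = refl
isSpine-spine (node tt leaf r) s = cong (node tt leaf) (isSpine-spine r s)
isSpine-spine (node _ (node _ _ _) _) ()

mutual
  uncode : ∀ k t → valid k t ≡ true → Σ (List (Term k)) λ xs → Decreasing xs × code k xs ≡ t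
  uncode zero leaf _ = [] , [] , refl
  uncode zero (node tt leaf r) s = ([] , spineLength r) ∷ [] , [ _ ] , cong (node tt leaf) (sym (isSpine-spine r s))
  uncode zero (node _ (node _ _ _) _) ()
  uncode (suc k) leaf _ = [] , [] , refl
  uncode (suc k) (node _ leaf _) ()
  uncode (suc k) (node tt l@(node _ _ _) r) v with Equivalence.to ∧-true v
  ... | vl , vr with uncode k l vl | uncodeBelow k r vr
  ...   | [] , _ , ex | _ with trans (sym (code-[] k)) ex
  ...     | ()
  uncode (suc k) (node tt l@(node _ _ _) r) v
      | vl , vr | (e , c) ∷ xs , dxs , ex | ts , dts , bts , ets =
    map (extend (spineLength r)) ((e , c) ∷ xs) ++ ts , extend-decreasing _ dxs dts bts ,
    trans (codeBelow-extend k _ ((e , c) ∷ xs) bts) (cong₂ (node tt) ex ets)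

  uncodeBelow : ∀ k t → validBelow k t ≡ true
              → Σ (List (Term (suc k))) λ ts → Decreasing ts × Bounded (spineLength t) ts × codeBelow k (spineLength t) ts ≡ t
  uncodeBelow k leaf _ = [] , [] , tt , refl
  uncodeBelow k (node tt l r) v with Equivalence.to ∧-true v
  ... | vl , vr with uncode k l vl | uncodeBelow k r vr
  ...   | xs , dxs , ex | ts , dts , bts , ets =
    map (extend (spineLength r)) xs ++ ts , extend-decreasing _ dxs dts bts , extend-bounded _ xs bts ,
    trans (codeBelow-extend k _ xs bts) (cong₂ (node tt) ex ets)

-- The domain automaton: validity is computed bottom-up

mutual
  profile : (ℕ → Shape → Bool) → ∀ n → Shape → Vec Bool (suc n)
  profile P n t = P n t ∷ profileBelow P n t

  profileBelow : (ℕ → Shape → Bool) → ∀ n → Shape → Vec Bool n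
  profileBelow P zero t = []
  profileBelow P (suc n) t = profile P n t

stepValid : ∀ n → Bool → Bool → Vec Bool (suc n) → Vec Bool (suc n) → Vec Bool (suc n)
stepValid zero nonEmptyₗ isSpineᵣ _ _ = (not nonEmptyₗ ∧ isSpineᵣ) ∷ []
stepValid (suc n) nonEmptyₗ isSpineᵣ (_ ∷ validₗ) (_ ∷ validBelowᵣ) =
  (nonEmptyₗ ∧ (headᵛ validₗ ∧ headᵛ validBelowᵣ)) ∷ stepValid n nonEmptyₗ isSpineᵣ validₗ validBelowᵣ

stepValid-node : ∀ n l r → stepValid n (nonEmpty l) (isSpine r) (profile valid n l) (profile validBelow n r)
                         ≡ profile valid n (node tt l r)
stepValid-node zero l r = refl
stepValid-node (suc n) l r = cong (valid (suc n) (node tt l r) ∷_) (stepValid-node n l r)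

zipWith-validBelow : ∀ n l r → zipWith _∧_ (profile valid n l) (profile validBelow n r) ≡ profile validBelow n (node tt l r)
zipWith-validBelow zero l r = refl
zipWith-validBelow (suc n) l r = cong (validBelow (suc n) (node tt l r) ∷_) (zipWith-validBelow n l r)

Summary : ℕ → Set
Summary k = Bool × Bool × Vec Bool (suc k) × Vec Bool (suc k)

finite-Summary : ∀ k → Finite (Summary k)
finite-Summary k = finite-× finite-Bool (finite-× finite-Bool
  (finite-× (finite-Vec finite-Bool (suc k)) (finite-Vec finite-Bool (suc k))))

summary : ∀ k → Shape → Summary k
summary k t = nonEmpty t , isSpine t , profile valid k t , profile validBelow k t

stepSummary : ∀ k → Summary k → Summary k → Summary k
stepSummary k (nonEmptyₗ , _ , validₗ , _) (_ , isSpineᵣ , validᵣ , validBelowᵣ) =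
  true , (not nonEmptyₗ ∧ isSpineᵣ) , stepValid k nonEmptyₗ isSpineᵣ validₗ validBelowᵣ , zipWith _∧_ validₗ validBelowᵣ

summary-node : ∀ k l r → summary k (node tt l r) ≡ stepSummary k (summary k l) (summary k r)
summary-node k l r = cong₂ (λ v b → true , isSpine (node tt l r) , v , b)
  (sym (stepValid-node k l r)) (sym (zipWith-validBelow k l r))

module Domain (k : ℕ) =
  Computing (finite-Summary k) (summary k) (λ _ → stepSummary k) (λ _ → summary-node k) (λ (_ , _ , v , _) → headᵛ v)

Pair : Set
Pair = Tree (Maybe ⊤ × Maybe ⊤)

left : Pair → Shape
left leaf = leaf
left (node (just _ , _) l r) = node tt (left l) (left r)
left (node (nothing , _) _ _) = leaf

right : Pair → Shape
right leaf = leaf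
right (node (_ , just _) l r) = node tt (right l) (right r)
right (node (_ , nothing) _ _) = leaf

consistent : Pair → Bool
consistent leaf = true
consistent (node (just _ , just _) l r) = consistent l ∧ consistent r
consistent (node (just _ , nothing) l r) = (not (nonEmpty (right l)) ∧ not (nonEmpty (right r))) ∧ (consistent l ∧ consistent r)
consistent (node (nothing , just _) l r) = (not (nonEmpty (left l)) ∧ not (nonEmpty (left r))) ∧ (consistent l ∧ consistent r)
consistent (node (nothing , nothing) _ _) = false

left-conv : ∀ s s' → left (conv s s') ≡ s
left-conv leaf leaf = refl
left-conv leaf (node _ _ _) = refl
left-conv (node tt l r) leaf = cong₂ (node tt) (left-conv l leaf) (left-conv r leaf)
left-conv (node tt l r) (node _ l' r') = cong₂ (node tt) (left-conv l l') (left-conv r r')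

right-conv : ∀ s s' → right (conv s s') ≡ s'
right-conv leaf leaf = refl
right-conv leaf (node tt l' r') = cong₂ (node tt) (right-conv leaf l') (right-conv leaf r')
right-conv (node _ _ _) leaf = refl
right-conv (node _ l r) (node tt l' r') = cong₂ (node tt) (right-conv l l') (right-conv r r')

conv-consistent : ∀ s s' → consistent (conv s s') ≡ true
conv-consistent leaf leaf = refl
conv-consistent leaf (node _ l' r')
  rewrite left-conv leaf l' | left-conv leaf r' | conv-consistent leaf l' | conv-consistent leaf r' = refl
conv-consistent (node _ l r) leaf
  rewrite right-conv l leaf | right-conv r leaf | conv-consistent l leaf | conv-consistent r leaf = refl
conv-consistent (node _ l r) (node _ l' r') rewrite conv-consistent l l' | conv-consistent r r' = refl

empty-leaf : ∀ {t} → not (nonEmpty t) ≡ true → t ≡ leaf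
empty-leaf {leaf} _ = refl

consistent-conv : ∀ u → consistent u ≡ true → conv (left u) (right u) ≡ u
consistent-conv leaf _ = refl
consistent-conv (node (just tt , just tt) l r) c
  with Equivalence.to ∧-true c
... | cl , cr = cong₂ (node _) (consistent-conv l cl) (consistent-conv r cr)
consistent-conv (node (just tt , nothing) l r) c
  with Equivalence.to ∧-true c
... | empty , clr with Equivalence.to ∧-true empty | Equivalence.to ∧-true clr
...   | el , er | cl , cr = cong₂ (node _)
  (trans (cong (conv (left l)) (sym (empty-leaf el))) (consistent-conv l cl))
  (trans (cong (conv (left r)) (sym (empty-leaf er))) (consistent-conv r cr))
consistent-conv (node (nothing , just tt) l r) c
  with Equivalence.to ∧-true c
... | empty , clr with Equivalence.to ∧-true empty | Equivalence.to ∧-true clr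
...   | el , er | cl , cr = cong₂ (node _)
  (trans (cong (λ s → conv s (right l)) (sym (empty-leaf el))) (consistent-conv l cl))
  (trans (cong (λ s → conv s (right r)) (sym (empty-leaf er))) (consistent-conv r cr))

-- The order automaton

-- consistency, the domain summaries of both components, and the two
-- comparisons that determine 'cmp' at the parent
OrderSummary : ℕ → Set
OrderSummary k = Bool × Summary k × Summary k × Cmp × Cmp

finite-OrderSummary : ∀ k → Finite (OrderSummary k)
finite-OrderSummary k = finite-× finite-Bool (finite-× (finite-Summary k)
  (finite-× (finite-Summary k) (finite-× finite-Cmp finite-Cmp)))

orderSummary : ∀ k → Pair → OrderSummary k
orderSummary k u = consistent u , summary k (left u) , summary k (right u) , spineCmp (left u) (right u) , cmp (left u) (right u)

stepOrder : ∀ k → Maybe ⊤ × Maybe ⊤ → OrderSummary k → OrderSummary k → OrderSummary k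
stepOrder k (just _ , just _) (cₗ , sₗ , sₗ' , _ , oₗ) (cᵣ , sᵣ , sᵣ' , spineᵣ , oᵣ) =
  cₗ ∧ cᵣ , stepSummary k sₗ sᵣ , stepSummary k sₗ' sᵣ' , spineᵣ , spineᵣ ⊙ oₗ ⊙ oᵣ
stepOrder k (just _ , nothing) (cₗ , sₗ , (nₗ' , _) , _) (cᵣ , sᵣ , (nᵣ' , _) , _) =
  (not nₗ' ∧ not nᵣ') ∧ (cₗ ∧ cᵣ) , stepSummary k sₗ sᵣ , summary k leaf , gt , gt
stepOrder k (nothing , just _) (cₗ , (nₗ , _) , sₗ' , _) (cᵣ , (nᵣ , _) , sᵣ' , _) =
  (not nₗ ∧ not nᵣ) ∧ (cₗ ∧ cᵣ) , summary k leaf , stepSummary k sₗ' sᵣ' , lt , lt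
stepOrder k (nothing , nothing) _ _ = false , summary k leaf , summary k leaf , eq , eq

orderSummary-node : ∀ k a l r → orderSummary k (node a l r) ≡ stepOrder k a (orderSummary k l) (orderSummary k r)
orderSummary-node k (just tt , just tt) l r
  rewrite summary-node k (left l) (left r) | summary-node k (right l) (right r) = refl
orderSummary-node k (just tt , nothing) l r rewrite summary-node k (left l) (left r) = refl
orderSummary-node k (nothing , just tt) l r rewrite summary-node k (right l) (right r) = refl
orderSummary-node k (nothing , nothing) l r = refl

finalOrder : ∀ {k} → OrderSummary k → Bool
finalOrder (c , (_ , _ , validₗ , _) , (_ , _ , validᵣ , _) , _ , o) = c ∧ (headᵛ validₗ ∧ (headᵛ validᵣ ∧ leq o))

module Order (k : ℕ) = Computing (finite-OrderSummary k) (orderSummary k) (stepOrder k) (orderSummary-node k) finalOrder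

OrderedPair : ℕ → Pair → Set
OrderedPair k u = consistent u ≡ true × valid k (left u) ≡ true × valid k (right u) ≡ true
                × leq (cmp (left u) (right u)) ≡ true

accepts-order : ∀ k u → Accepts (Order.automaton k) u ⇔ OrderedPair k u
accepts-order k u = ∧₄-true ⇔-∘ Order.accepts k u

μ : ∀ k → Ord k → Shape
μ k (xs , _) = code k xs

ordered-sound : ∀ k u → OrderedPair k u → ∃ λ x → ∃ λ y → x ≤ₒ y × conv (μ k x) (μ k y) ≡ u
ordered-sound k u (c , validₗ , validᵣ , le) with uncode k (left u) validₗ | uncode k (right u) validᵣ
... | xs , dxs , exs | ys , dys , eys =
  (xs , dxs) , (ys , dys) ,
  Equivalence.from (code-leq k dxs dys) (subst₂ (λ s t → leq (cmp s t) ≡ true) (sym exs) (sym eys) le) ,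
  trans (cong₂ conv exs eys) (consistent-conv u c)

ordered-complete : ∀ k (x y : Ord k) → x ≤ₒ y → OrderedPair k (conv (μ k x) (μ k y))
ordered-complete k (xs , dxs) (ys , dys) x≤y
  rewrite left-conv (code k xs) (code k ys) | right-conv (code k xs) (code k ys) =
  conv-consistent (code k xs) (code k ys) , code-valid k dxs , code-valid k dys , Equivalence.to (code-leq k dxs dys) x≤y

lemma17 : (k : ℕ) → TreeAutomaticPresentation ⊤ (Ord k) _≈ₒ_ _≤ₒ_
lemma17 k = record
  { 𝒜 = Domain.automaton k
  ; 𝒜R = Order.automaton k
  ; μ = μ k
  ; μ-injective = λ (_ , dxs) (_ , dys) → code-injective k dxs dys
  ; μ-into = λ (xs , dxs) → Equivalence.from (Domain.accepts k (code k xs)) (code-valid k dxs)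
  ; μ-onto = λ t accepted →
      let (xs , dxs , exs) = uncode k t (Equivalence.to (Domain.accepts k t) accepted) in (xs , dxs) , exs
  ; 𝒜R-correct = λ u → mk⇔
      (ordered-sound k u ∘ Equivalence.to (accepts-order k u))
      (λ (x , y , x≤y , conv≡u) → Equivalence.from (accepts-order k u) (subst (OrderedPair k) conv≡u (ordered-complete k x y x≤y)))
  }
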